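{- Let $\mathcal{G}$ be a valued digraph with vertex set $V$, let $A\in IS(\mathcal{G})$, and let $\mathcal{U}=(\mathcal{U}_z)_{z\in V}$ be a family of subsets of $V$. Then the formal power series $\Gamma(A,\mathcal{U})=\sum_{f\in\mathrm{SSF}(A,\mathcal{U})}\prod_{z\in A}x_{f(z)}$ is a quasi-symmetric function.
   Context: Valued digraph: pair $(G,\theta)$, $G=(V,E)$ simple acyclic, $\theta:V\to\mathbb{N}$ with $0\le\theta(x)\le d^+(x)$. Erasable vertex: $\theta(x)=0$ and every $z$ with $(z,x)\in E$ has $\theta(z)\ne0$. Peeling process: repeatedly choose an erasable vertex $x_i$, delete it with its incident arcs, and decrease by $1$ the value of each $y$ with an arc $(y,x_i)$. $IS(\mathcal{G})$: $\emptyset$ and the sets of first $k\ge1$ entries of peeling sequences. For $A\in IS(\mathcal{G})$, $PS_A(\mathcal{G})$ is the set of sequences $[z_1,\dots,z_{|A|}]$ with $A=\{z_1,\dots,z_{|A|}\}$ that are the first $|A|$ terms of some peeling sequence of $\mathcal{G}$. A family $\mathcal{U}=(\mathcal{U}_z)_{z\in V}$ of subsets of $V$ is a set of generalized columns. A function $f:A\to\mathbb{N}^*=\{1,2,\dots\}$ is $(A,\mathcal{U})$-semi-standard if there exists $[z_1,\dots,z_n]\in PS_A(\mathcal{G})$ ($n=|A|$) such that for all $1\le i<j\le n$: $f(z_i)\le f(z_j)$, and $f(z_i)<f(z_j)$ whenever $z_j\in\mathcal{U}_{z_i}$; $\mathrm{SSF}(A,\mathcal{U})$ denotes the set of these functions.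 A formal power series $F(x_1,x_2,\dots)$ of bounded degree is quasi-symmetric if for every $k$ and all $i_1<\dots<i_k$, $j_1<\dots<j_k$ and exponents $\alpha_1,\dots,\alpha_k\ge1$, the monomials $x_{i_1}^{\alpha_1}\cdots x_{i_k}^{\alpha_k}$ and $x_{j_1}^{\alpha_1}\cdots x_{j_k}^{\alpha_k}$ have the same coefficient. -}

module Defs where

open import Data.Nat using (ℕ; zero; suc; _+_; _∸_; _≤_; _<_)
open import Data.Nat.Properties using (_≟_)
open import Data.Bool using (Bool; true; false; if_then_else_; _∧_)
open import Data.Fin using (Fin; toℕ) renaming (_<_ to _<ᶠ_)
open import Data.Nat.ListAction using (sum)
open import Data.List using (List; []; _∷_; length; map; take; lookup; allFin; _++_)
open import Data.List.Membership.Propositional using (_∈_; _∉_)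
open import Data.List.Relation.Unary.Unique.Propositional using (Unique)
open import Data.Vec using (Vec) renaming (lookup to vlookup)
open import Data.Fin.Subset using (Subset; ∣_∣) renaming (_∈_ to _∈ₛ_; _∉_ to _∉ₛ_)
open import Data.Fin.Subset.Properties using (_∈?_)
open import Data.Product using (Σ; ∃; ∃-syntax; _×_; _,_)
open import Data.Sum using (_⊎_)
open import Data.Empty using (⊥)
open import Relation.Nullary using (¬_)
open import Relation.Nullary.Decidable using (⌊_⌋)
open import Relation.Binary.PropositionalEquality using (_≡_; _≢_)
open import Function.Bundles using (_⇔_)

countFin : ∀ {n} → (Fin n → Bool) → ℕ
countFin {n} p = sum (map (λ z → if p z then 1 else 0) (allFin n))

data Path⁺ {n : ℕ} (E : Fin n → Fin n → Bool) : Fin n → Fin n → Set where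
  edge : ∀ {x y} → E x y ≡ true → Path⁺ E x y
  step : ∀ {x y z} → E x y ≡ true → Path⁺ E y z → Path⁺ E x z

outdeg : ∀ {n} → (Fin n → Fin n → Bool) → Fin n → ℕ
outdeg E x = countFin (λ y → E x y)

record ValuedDigraph (n : ℕ) : Set where
  field
    E       : Fin n → Fin n → Bool
    noLoop  : ∀ x → E x x ≡ false
    acyclic : ∀ x → ¬ Path⁺ E x x
    θ       : Fin n → ℕ
    θ≤d⁺    : ∀ x → θ x ≤ outdeg E x

module _ {n : ℕ} (G : ValuedDigraph n) where
  open ValuedDigraph G

  -- current value of y after the vertices of the list S (distinct) have
  -- been erased: θ(y) minus the number of erased out-neighbours of y
  val : List (Fin n) → Fin n → ℕ
  val S y = θ y ∸ sum (map (λ x → if E y x then 1 else 0) S)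

  Erasable : List (Fin n) → Fin n → Set
  Erasable S x =
    x ∉ S × val S x ≡ 0 × (∀ z → z ∉ S → E z x ≡ true → val S z ≢ 0)

  ValidSeq : List (Fin n) → Set
  ValidSeq s = ∀ (i : Fin (length s)) → Erasable (take (toℕ i) s) (lookup s i)

  PeelingSeq : List (Fin n) → Set
  PeelingSeq s = ValidSeq s × (∀ x → ¬ Erasable s x)

  SameSet : Subset n → List (Fin n) → Set
  SameSet A p = ∀ z → (z ∈ₛ A) ⇔ (z ∈ p)

  IS : Subset n → Set
  IS A = (∀ z → z ∉ₛ A)
       ⊎ (∃[ s ] PeelingSeq s × ∃[ k ] (1 ≤ k × k ≤ length s × SameSet A (take k s)))

  PS : Subset n → List (Fin n) → Set
  PS A p = length p ≡ ∣ A ∣ × SameSet A p × ∃[ s' ] PeelingSeq (p ++ s')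

  -- Functions f : A → ℕ* are encoded as vectors f : Vec ℕ n with
  -- f z ≥ 1 for z ∈ A and f z = 0 for z ∉ A (a bijective encoding).
  EncodesFun : Subset n → Vec ℕ n → Set
  EncodesFun A f = ∀ z → (z ∈ₛ A → 1 ≤ vlookup f z) × (z ∉ₛ A → vlookup f z ≡ 0)

  SSF : Subset n → (Fin n → Subset n) → Vec ℕ n → Set
  SSF A U f = EncodesFun A f ×
    ∃[ p ] (PS A p ×
      (∀ (i j : Fin (length p)) → i <ᶠ j →
          vlookup f (lookup p i) ≤ vlookup f (lookup p j)
        × (lookup p j ∈ₛ U (lookup p i) → vlookup f (lookup p i) < vlookup f (lookup p j))))

-- exponent of x_m in the monomial x_{i_1}^{α_1} ⋯ x_{i_k}^{α_k}
expAt : ∀ {k} → Vec ℕ k → Vec ℕ k → ℕ → ℕ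
expAt Data.Vec.[] Data.Vec.[] m = 0
expAt (i Data.Vec.∷ is) (a Data.Vec.∷ as) m = if ⌊ i ≟ m ⌋ then a else expAt is as m

-- exponent of x_m in ∏_{z ∈ A} x_{f(z)}
fibre : ∀ {n} → Subset n → Vec ℕ n → ℕ → ℕ
fibre A f m = countFin (λ z → ⌊ z ∈? A ⌋ ∧ ⌊ vlookup f z ≟ m ⌋)

-- ∏_{z ∈ A} x_{f(z)} = x_{i_1}^{α_1} ⋯ x_{i_k}^{α_k}   (variables x_1, x_2, …)
HasMonomial : ∀ {n k} → Subset n → Vec ℕ n → Vec ℕ k → Vec ℕ k → Set
HasMonomial A f idx α = ∀ m → 1 ≤ m → fibre A f m ≡ expAt idx α m

HasCard : ∀ {n} → (Vec ℕ n → Set) → ℕ → Set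
HasCard {n} P c = Σ (List (Vec ℕ n)) λ l → Unique l × length l ≡ c × (∀ f → (f ∈ l) ⇔ P f)

ΓCoeff : ∀ {n} → ValuedDigraph n → Subset n → (Fin n → Subset n)
       → ∀ {k} → Vec ℕ k → Vec ℕ k → ℕ → Set
ΓCoeff G A U idx α c = HasCard (λ f → SSF G A U f × HasMonomial A f idx α) c

data StrictIncPos : ∀ {k} → Vec ℕ k → Set where
  []  : StrictIncPos Data.Vec.[]
  [_] : ∀ {i} → 1 ≤ i → StrictIncPos (i Data.Vec.∷ Data.Vec.[])
  _∷_ : ∀ {k i j} {is : Vec ℕ k} → 1 ≤ i → i < j → StrictIncPos (j Data.Vec.∷ is)
      → StrictIncPos (i Data.Vec.∷ j Data.Vec.∷ is)

AllPos : ∀ {k} → Vec ℕ k → Set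
AllPos α = ∀ t → 1 ≤ vlookup α t

-- Quasi-symmetry of a series given by its coefficient relation:
-- for i_1<…<i_k, j_1<…<j_k and α_t ≥ 1, the two monomials have the
-- same (well-defined) coefficient.
QuasiSymmetric : (∀ {k} → Vec ℕ k → Vec ℕ k → ℕ → Set) → Set
QuasiSymmetric Coeff =
  ∀ k (idx jdx α : Vec ℕ k) → StrictIncPos idx → StrictIncPos jdx → AllPos α →
  ∃[ c ] (Coeff idx α c × Coeff jdx α c)

module Submission where

-- The coefficient of x_{i₁}^{α₁} ⋯ x_{i_k}^{α_k} in Γ(A, U) counts the
-- (A, U)-semi-standard functions f whose values, with multiplicity, are
-- i₁^{α₁} ⋯ i_k^{α_k}.  Semi-standardness only sees the relative order of
-- the values of f, so for a second sequence j₁ < ⋯ < j_k the order-preserving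
-- relabelling i_t ↦ j_t maps these functions bijectively onto the functions
-- counted by the coefficient of x_{j₁}^{α₁} ⋯ x_{j_k}^{α_k}.  The coefficients
-- exist since the counted set is finite and decidable: its functions take
-- values in {0, …, i₁ + ⋯ + i_k}, and SSF(A, U) is decided by a finite search
-- over peeling sequences.
--
-- The theorem combines these.

open import Defs
open import Data.Nat using (ℕ; zero; suc; _+_; _≤_; _<_; z≤n; s≤s; _≤?_; _<?_)
open import Data.Nat.Properties
  using (_≟_; ≤-trans; <-trans; <-irrefl; <-asym; <⇒≤; ≤-reflexive; ≰⇒>; m≤m+n; m≤n+m; m≤n⇒m<n∨m≡n; suc-injective; allUpTo?)
open import Data.Bool using (Bool; true; false; if_then_else_; _∧_)
open import Data.Bool.Properties using () renaming (_≟_ to _≟ᵇ_)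
open import Data.Fin using (Fin; toℕ; fromℕ<) renaming (_<_ to _<ᶠ_; _≟_ to _≟ᶠ_)
open import Data.Fin.Properties using (any?; all?; pigeonhole; toℕ-fromℕ<; <-cmp) renaming (_<?_ to _<ᶠ?_)
open import Data.Nat.ListAction using (sum)
open import Data.List using (List; []; _∷_; length; map; take; lookup; allFin; _++_; upTo; filter; deduplicate; cartesianProductWith)
open import Data.List.Properties using (length-map; length-++-≤ʳ)
open import Data.List.Membership.Propositional using (_∈_)
open import Data.List.Membership.Propositional.Properties
  using (∈-lookup; ∈-allFin; ∈-map⁺; ∈-map⁻; ∈-filter⁺; ∈-filter⁻; ∈-deduplicate⁺; ∈-deduplicate⁻; ∈-upTo⁺; ∈-cartesianProductWith⁺)
open import Data.List.Relation.Unary.Any using (here; there)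
import Data.List.Relation.Unary.All as All
open import Data.List.Relation.Unary.All.Properties using (map⁺)
open import Data.List.Relation.Unary.AllPairs using ([]; _∷_)
open import Data.List.Relation.Unary.Unique.Propositional using (Unique)
open import Data.List.Relation.Unary.Unique.DecPropositional.Properties using (deduplicate-!)
open import Data.Vec using (Vec; []; _∷_; tabulate) renaming (lookup to vlookup; map to vmap; sum to vsum)
open import Data.Vec.Properties using (lookup-map; map-∘; tabulate-cong; tabulate∘lookup; ≡-dec)
open import Data.Fin.Subset using (Subset; ∣_∣) renaming (_∈_ to _∈ₛ_)
open import Data.Fin.Subset.Properties using (_∈?_)
open import Data.Product using (∃-syntax; _×_; _,_; proj₁; proj₂)
open import Data.Sum using (inj₁; inj₂)
open import Data.Empty using (⊥-elim)
open import Function using (_∘_)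
open import Relation.Binary.Definitions using (tri<; tri≈; tri>)
open import Relation.Nullary using (¬_; Dec; yes; no; ¬?)
open import Relation.Nullary.Decidable using (⌊_⌋; _×-dec_; _→-dec_; map′; does-⇔; isYes≗does)
open import Relation.Binary.PropositionalEquality using (_≡_; _≢_; refl; sym; trans; cong; subst; subst₂; module ≡-Reasoning)
open import Function.Bundles using (_⇔_; mk⇔; Equivalence)

private
  variable
    n k : ℕ

map-fixes : (g : ℕ → ℕ) (v : Vec ℕ n) → (∀ z → g (vlookup v z) ≡ vlookup v z) → vmap g v ≡ v
map-fixes g v fixed = begin
  vmap g v                   ≡⟨ sym (tabulate∘lookup (vmap g v)) ⟩
  tabulate (vlookup (vmap g v)) ≡⟨ tabulate-cong (λ z → trans (lookup-map z g v) (fixed z)) ⟩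
  tabulate (vlookup v)       ≡⟨ tabulate∘lookup v ⟩
  v                          ∎
  where open ≡-Reasoning

indicatorSum : {X : Set} → List X → (X → Bool) → ℕ
indicatorSum l p = sum (map (λ z → if p z then 1 else 0) l)

indicatorSum-pos : {X : Set} (l : List X) (p : X → Bool) {z : X} → z ∈ l → p z ≡ true → 1 ≤ indicatorSum l p
indicatorSum-pos (x ∷ l) p (here refl) pz rewrite pz = s≤s z≤n
indicatorSum-pos (x ∷ l) p (there z∈l) pz = ≤-trans (indicatorSum-pos l p z∈l pz) (m≤n+m _ (if p x then 1 else 0))

indicatorSum-zero : {X : Set} (l : List X) (p : X → Bool) → (∀ z → p z ≡ false) → indicatorSum l p ≡ 0
indicatorSum-zero []      p never = refl
indicatorSum-zero (x ∷ l) p never rewrite never x = indicatorSum-zero l p never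

indicatorSum-cong : {X : Set} (l : List X) (p q : X → Bool) → (∀ z → p z ≡ q z) → indicatorSum l p ≡ indicatorSum l q
indicatorSum-cong []      p q same = refl
indicatorSum-cong (x ∷ l) p q same rewrite same x = cong (_ +_) (indicatorSum-cong l p q same)

⌊⌋-⇔ : {P Q : Set} → P ⇔ Q → (p? : Dec P) (q? : Dec Q) → ⌊ p? ⌋ ≡ ⌊ q? ⌋
⌊⌋-⇔ P⇔Q p? q? = trans (isYes≗does p?) (trans (does-⇔ P⇔Q p? q?) (sym (isYes≗does q?)))

fibre-pos : (A : Subset n) (f : Vec ℕ n) (z : Fin n) → z ∈ₛ A → 1 ≤ fibre A f (vlookup f z)
fibre-pos A f z z∈A = indicatorSum-pos (allFin _) _ (∈-allFin z) counted
  where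
  counted : ⌊ z ∈? A ⌋ ∧ ⌊ vlookup f z ≟ vlookup f z ⌋ ≡ true
  counted with z ∈? A | vlookup f z ≟ vlookup f z
  ... | yes _   | yes _    = refl
  ... | yes _   | no ≢self = ⊥-elim (≢self refl)
  ... | no z∉A  | _        = ⊥-elim (z∉A z∈A)

fibre-zero : (A : Subset n) (f : Vec ℕ n) (m : ℕ) → (∀ z → z ∈ₛ A → vlookup f z ≢ m) → fibre A f m ≡ 0
fibre-zero A f m missed = indicatorSum-zero (allFin _) _ uncounted
  where
  uncounted : ∀ z → ⌊ z ∈? A ⌋ ∧ ⌊ vlookup f z ≟ m ⌋ ≡ false
  uncounted z with z ∈? A | vlookup f z ≟ m
  ... | no _    | _      = refl
  ... | yes _   | no _   = refl
  ... | yes z∈A | yes eq = ⊥-elim (missed z z∈A eq)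

fibre-relabel : (A : Subset n) (f : Vec ℕ n) (h : ℕ → ℕ) (m m′ : ℕ)
  → (∀ z → z ∈ₛ A → (h (vlookup f z) ≡ m) ⇔ (vlookup f z ≡ m′))
  → fibre A (vmap h f) m ≡ fibre A f m′
fibre-relabel A f h m m′ matched = indicatorSum-cong (allFin _) _ _ pointwise
  where
  pointwise : ∀ z → ⌊ z ∈? A ⌋ ∧ ⌊ vlookup (vmap h f) z ≟ m ⌋ ≡ ⌊ z ∈? A ⌋ ∧ ⌊ vlookup f z ≟ m′ ⌋
  pointwise z with z ∈? A
  ... | no _ = refl
  ... | yes z∈A rewrite lookup-map z h f = ⌊⌋-⇔ (matched z z∈A) (h (vlookup f z) ≟ m) (vlookup f z ≟ m′)

head-pos : ∀ {i} {is : Vec ℕ k} → StrictIncPos (i ∷ is) → 1 ≤ i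
head-pos [ 1≤i ]     = 1≤i
head-pos (_∷_ 1≤i _ _) = 1≤i

tail-inc : ∀ {i} {is : Vec ℕ k} → StrictIncPos (i ∷ is) → StrictIncPos is
tail-inc [ _ ]        = []
tail-inc (_∷_ _ _ rest) = rest

head<tail : ∀ {i} {is : Vec ℕ k} → StrictIncPos (i ∷ is) → ∀ t → i < vlookup is t
head<tail (_∷_ _ i<j _)    Fin.zero    = i<j
head<tail (_∷_ _ i<j rest) (Fin.suc t) = <-trans i<j (head<tail rest t)

lookup-pos : {idx : Vec ℕ k} → StrictIncPos idx → ∀ t → 1 ≤ vlookup idx t
lookup-pos {idx = _ ∷ _} inc Fin.zero    = head-pos inc
lookup-pos {idx = _ ∷ _} inc (Fin.suc t) = ≤-trans (head-pos inc) (<⇒≤ (head<tail inc t))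

lookup-mono : {idx : Vec ℕ k} → StrictIncPos idx → ∀ {s t} → s <ᶠ t → vlookup idx s < vlookup idx t
lookup-mono {idx = _ ∷ _} inc {Fin.zero}  {Fin.suc t} _         = head<tail inc t
lookup-mono {idx = _ ∷ _} inc {Fin.suc s} {Fin.suc t} (s≤s s<t) = lookup-mono (tail-inc inc) s<t

lookup-reflects : {idx : Vec ℕ k} → StrictIncPos idx → ∀ {s t} → vlookup idx s < vlookup idx t → s <ᶠ t
lookup-reflects inc {s} {t} lt with <-cmp s t
... | tri< s<t _ _ = s<t
... | tri≈ _ refl _ = ⊥-elim (<-irrefl refl lt)
... | tri> _ _ t<s = ⊥-elim (<-asym lt (lookup-mono inc t<s))

Occurs : Vec ℕ k → ℕ → Set
Occurs idx u = ∃[ t ] vlookup idx t ≡ u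

occurs? : (idx : Vec ℕ k) (u : ℕ) → Dec (Occurs idx u)
occurs? idx u = any? (λ t → vlookup idx t ≟ u)

expAt-lookup : {idx : Vec ℕ k} → StrictIncPos idx → ∀ (α : Vec ℕ k) t → expAt idx α (vlookup idx t) ≡ vlookup α t
expAt-lookup {idx = i ∷ is} inc (a ∷ α) Fin.zero with i ≟ i
... | yes _   = refl
... | no i≢i  = ⊥-elim (i≢i refl)
expAt-lookup {idx = i ∷ is} inc (a ∷ α) (Fin.suc t) with i ≟ vlookup is t
... | yes i≡  = ⊥-elim (<-irrefl i≡ (head<tail inc t))
... | no _    = expAt-lookup (tail-inc inc) α t

expAt-absent : (idx α : Vec ℕ k) (m : ℕ) → ¬ Occurs idx m → expAt idx α m ≡ 0
expAt-absent []       []  m _ = refl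
expAt-absent (i ∷ is) (a ∷ α) m absent with i ≟ m
... | yes i≡m = ⊥-elim (absent (Fin.zero , i≡m))
... | no _    = expAt-absent is α m (λ { (t , eq) → absent (Fin.suc t , eq) })

zero-absent : {idx : Vec ℕ k} → StrictIncPos idx → ¬ Occurs idx 0
zero-absent inc (t , eq) with () ← subst (1 ≤_) eq (lookup-pos inc t)

expAt-zero : {idx : Vec ℕ k} → StrictIncPos idx → ∀ (α : Vec ℕ k) → expAt idx α 0 ≡ 0
expAt-zero {idx = idx} inc α = expAt-absent idx α 0 (zero-absent inc)

expAt-occurs : (idx α : Vec ℕ k) (m : ℕ) → 1 ≤ expAt idx α m → Occurs idx m
expAt-occurs idx α m pos with occurs? idx m
... | yes occ   = occ
... | no absent with () ← subst (1 ≤_) (expAt-absent idx α m absent) pos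

module Relabelling {idx jdx : Vec ℕ k} (inc-i : StrictIncPos idx) (inc-j : StrictIncPos jdx) where

  -- the relabelling i_t ↦ j_t and its inverse j_t ↦ i_t, both 0 elsewhere
  φ ψ : ℕ → ℕ
  φ = expAt idx jdx
  ψ = expAt jdx idx

  φ-pos : ∀ {u} → Occurs idx u → 1 ≤ φ u
  φ-pos (t , refl) = subst (1 ≤_) (sym (expAt-lookup inc-i jdx t)) (lookup-pos inc-j t)

  φ-mono : ∀ {u v} → Occurs idx u → Occurs idx v → u < v → φ u < φ v
  φ-mono (s , refl) (t , refl) lt =
    subst₂ _<_ (sym (expAt-lookup inc-i jdx s)) (sym (expAt-lookup inc-i jdx t))
      (lookup-mono inc-j (lookup-reflects inc-i lt))

  ψ∘φ : ∀ {u} → Occurs idx u → ψ (φ u) ≡ u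
  ψ∘φ (t , refl) = trans (cong ψ (expAt-lookup inc-i jdx t)) (expAt-lookup inc-j idx t)

  φ-matches-ψ : ∀ {u} → Occurs idx u → ∀ m → (φ u ≡ m) ⇔ (u ≡ ψ m)
  φ-matches-ψ {u} occ m = mk⇔ (λ φu≡m → trans (sym (ψ∘φ occ)) (cong ψ φu≡m)) from
    where
    from : u ≡ ψ m → φ u ≡ m
    from u≡ψm with occurs? jdx m
    ... | yes (t , refl) = begin
        φ u                   ≡⟨ cong φ u≡ψm ⟩
        φ (ψ (vlookup jdx t)) ≡⟨ cong φ (expAt-lookup inc-j idx t) ⟩
        φ (vlookup idx t)     ≡⟨ expAt-lookup inc-i jdx t ⟩
        vlookup jdx t         ∎
      where open ≡-Reasoning
    ... | no absent = ⊥-elim (zero-absent inc-i (subst (Occurs idx) (trans u≡ψm (expAt-absent jdx idx m absent)) occ))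

  exponent-ψ : ∀ (α : Vec ℕ k) m → expAt jdx α m ≡ expAt idx α (ψ m)
  exponent-ψ α m with occurs? jdx m
  ... | yes (t , refl) = begin
      expAt jdx α (vlookup jdx t)     ≡⟨ expAt-lookup inc-j α t ⟩
      vlookup α t                     ≡⟨ sym (expAt-lookup inc-i α t) ⟩
      expAt idx α (vlookup idx t)     ≡⟨ cong (expAt idx α) (sym (expAt-lookup inc-j idx t)) ⟩
      expAt idx α (ψ (vlookup jdx t)) ∎
    where open ≡-Reasoning
  ... | no absent = begin
      expAt jdx α m          ≡⟨ expAt-absent jdx α m absent ⟩
      0                      ≡⟨ sym (expAt-zero inc-i α) ⟩
      expAt idx α 0          ≡⟨ cong (expAt idx α) (sym (expAt-absent jdx idx m absent)) ⟩
      expAt idx α (ψ m)      ∎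
    where open ≡-Reasoning

Ordered : (Fin n → Subset n) → Vec ℕ n → List (Fin n) → Set
Ordered U f p = ∀ (i j : Fin (length p)) → i <ᶠ j →
    vlookup f (lookup p i) ≤ vlookup f (lookup p j)
  × (lookup p j ∈ₛ U (lookup p i) → vlookup f (lookup p i) < vlookup f (lookup p j))

ssf-relabel : (G : ValuedDigraph n) (A : Subset n) (U : Fin n → Subset n)
  (h : ℕ → ℕ) (S : ℕ → Set) (f : Vec ℕ n)
  → (∀ z → z ∈ₛ A → S (vlookup f z))
  → h 0 ≡ 0 → (∀ {u} → S u → 1 ≤ h u) → (∀ {u v} → S u → S v → u < v → h u < h v)
  → SSF G A U f → SSF G A U (vmap h f)
ssf-relabel G A U h S f values h0 h-pos h-mono (encodes , p , ps@(_ , sameSet , _) , ordered) =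
  encodes′ , p , ps , ordered′
  where
  value : ∀ z → vlookup (vmap h f) z ≡ h (vlookup f z)
  value z = lookup-map z h f

  encodes′ : EncodesFun G A (vmap h f)
  encodes′ z = (λ z∈A → subst (1 ≤_) (sym (value z)) (h-pos (values z z∈A)))
             , (λ z∉A → trans (value z) (trans (cong h (proj₂ (encodes z) z∉A)) h0))

  inS : ∀ i → S (vlookup f (lookup p i))
  inS i = values _ (Equivalence.from (sameSet (lookup p i)) (∈-lookup i))

  h-weak : ∀ i j → vlookup f (lookup p i) ≤ vlookup f (lookup p j) → h (vlookup f (lookup p i)) ≤ h (vlookup f (lookup p j))
  h-weak i j le with m≤n⇒m<n∨m≡n le
  ... | inj₁ lt = <⇒≤ (h-mono (inS i) (inS j) lt)
  ... | inj₂ eq = ≤-reflexive (cong h eq)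

  ordered′ : Ordered U (vmap h f) p
  ordered′ i j i<j =
      subst₂ _≤_ (sym (value _)) (sym (value _)) (h-weak i j (proj₁ (ordered i j i<j)))
    , λ inU → subst₂ _<_ (sym (value _)) (sym (value _)) (h-mono (inS i) (inS j) (proj₂ (ordered i j i<j) inU))

module Monomial (A : Subset n) {idx : Vec ℕ k} (inc : StrictIncPos idx) (α : Vec ℕ k) (f : Vec ℕ n)
                (positive : ∀ z → z ∈ₛ A → 1 ≤ vlookup f z) (monomial : HasMonomial A f idx α) where

  -- the monomial identity also holds at the index 0, where both sides vanish
  monomial-at : ∀ m → fibre A f m ≡ expAt idx α m
  monomial-at zero = trans (fibre-zero A f 0 (λ z z∈A f≡0 → <-irrefl (sym f≡0) (positive z z∈A)))
                           (sym (expAt-zero inc α))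
  monomial-at (suc m) = monomial (suc m) (s≤s z≤n)

  values-occur : ∀ z → z ∈ₛ A → Occurs idx (vlookup f z)
  values-occur z z∈A = expAt-occurs idx α (vlookup f z)
    (subst (1 ≤_) (monomial-at (vlookup f z)) (fibre-pos A f z z∈A))

Counted : ValuedDigraph n → Subset n → (Fin n → Subset n) → Vec ℕ k → Vec ℕ k → Vec ℕ n → Set
Counted G A U idx α f = SSF G A U f × HasMonomial A f idx α

module CountedRelabelling (G : ValuedDigraph n) (A : Subset n) (U : Fin n → Subset n) (α : Vec ℕ k)
                          {idx jdx : Vec ℕ k} (inc-i : StrictIncPos idx) (inc-j : StrictIncPos jdx) where
  open Relabelling inc-i inc-j

  counted-relabel : ∀ f → Counted G A U idx α f → Counted G A U jdx α (vmap φ f)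
  counted-relabel f (ssf , monomial) =
    ssf-relabel G A U φ (Occurs idx) f values-occur (expAt-zero inc-i jdx) φ-pos φ-mono ssf , monomial′
    where
    open Monomial A inc-i α f (λ z → proj₁ (proj₁ ssf z)) monomial
    open ≡-Reasoning
    monomial′ : HasMonomial A (vmap φ f) jdx α
    monomial′ m _ = begin
      fibre A (vmap φ f) m   ≡⟨ fibre-relabel A f φ m (ψ m) (λ z z∈A → φ-matches-ψ (values-occur z z∈A) m) ⟩
      fibre A f (ψ m)        ≡⟨ monomial-at (ψ m) ⟩
      expAt idx α (ψ m)      ≡⟨ sym (exponent-ψ α m) ⟩
      expAt jdx α m          ∎

  counted-inverse : ∀ f → Counted G A U idx α f → vmap ψ (vmap φ f) ≡ f
  counted-inverse f (ssf , monomial) = trans (sym (map-∘ ψ φ f)) (map-fixes (ψ ∘ φ) f fixed)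
    where
    open Monomial A inc-i α f (λ z → proj₁ (proj₁ ssf z)) monomial
    fixed : ∀ z → ψ (φ (vlookup f z)) ≡ vlookup f z
    fixed z with z ∈? A
    ... | yes z∈A = ψ∘φ (values-occur z z∈A)
    ... | no z∉A rewrite proj₂ (proj₁ ssf z) z∉A =
      trans (cong ψ (expAt-zero inc-i jdx)) (expAt-zero inc-j idx)

unique-map : {X Y : Set} (g : X → Y) (h : Y → X) {l : List X}
  → (∀ {x} → x ∈ l → h (g x) ≡ x) → Unique l → Unique (map g l)
unique-map g h {[]}    _       []            = []
unique-map g h {x ∷ l} retract (x∉l ∷ uniq) =
  map⁺ (All.tabulate distinct) ∷ unique-map g h (retract ∘ there) uniq
  where
  distinct : ∀ {y} → y ∈ l → g x ≢ g y
  distinct {y} y∈l gx≡gy =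
    All.lookup x∉l y∈l (trans (sym (retract (here refl))) (trans (cong h gx≡gy) (retract (there y∈l))))

hasCard-bijection : {P Q : Vec ℕ n → Set} {c : ℕ} (g h : Vec ℕ n → Vec ℕ n)
  → (∀ f → P f → Q (g f)) → (∀ f → Q f → P (h f))
  → (∀ f → P f → h (g f) ≡ f) → (∀ f → Q f → g (h f) ≡ f)
  → HasCard P c → HasCard Q c
hasCard-bijection {P = P} {Q} g h P⇒Q Q⇒P h∘g g∘h (l , unique , size , member) =
  map g l , unique-map g h (λ {f} f∈l → h∘g f (P-of f∈l)) unique , trans (length-map g l) size , member′
  where
  P-of : ∀ {f} → f ∈ l → P f
  P-of {f} = Equivalence.to (member f)

  member′ : ∀ f → (f ∈ map g l) ⇔ Q f
  member′ f = mk⇔ to from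
    where
    to : f ∈ map g l → Q f
    to f∈gl with f₀ , f₀∈l , refl ← ∈-map⁻ g f∈gl = P⇒Q f₀ (P-of f₀∈l)
    from : Q f → f ∈ map g l
    from Qf = subst (_∈ map g l) (g∘h f Qf) (∈-map⁺ g (Equivalence.from (member (h f)) (Q⇒P f Qf)))

_⇔-dec_ : {P Q : Set} → Dec P → Dec Q → Dec (P ⇔ Q)
p? ⇔-dec q? = map′ (λ { (to , from) → mk⇔ to from }) (λ P⇔Q → Equivalence.to P⇔Q , Equivalence.from P⇔Q)
  ((p? →-dec q?) ×-dec (q? →-dec p?))

exists-of-length? : (k : ℕ) (P : List (Fin n) → Set) → (∀ s → Dec (P s)) → Dec (∃[ s ] (length s ≡ k × P s))
exists-of-length? zero P P? with P? []
... | yes p = yes ([] , refl , p)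
... | no ¬p = no λ { ([] , _ , p) → ¬p p ; (_ ∷ _ , () , _) }
exists-of-length? (suc k) P P? with any? (λ x → exists-of-length? k (P ∘ (x ∷_)) (P? ∘ (x ∷_)))
... | yes (x , s , len , p) = yes (x ∷ s , cong suc len , p)
... | no ¬q = no λ { ([] , () , _) ; (x ∷ s , len , p) → ¬q (x , s , suc-injective len , p) }

lookup∈take : {X : Set} (s : List X) (i : Fin (length s)) (j : ℕ) → toℕ i < j → lookup s i ∈ take j s
lookup∈take (x ∷ s) Fin.zero    (suc j) _          = here refl
lookup∈take (x ∷ s) (Fin.suc i) (suc j) (s≤s i<j) = there (lookup∈take s i j i<j)

-- Every ingredient of SSF(A, U) is a finite check; the only unbounded search,
-- for a completion of p to a peeling sequence, is bounded by n since the
-- entries of a peeling sequence are distinct.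
module SSFDecidable {n : ℕ} (G : ValuedDigraph n) where
  open ValuedDigraph G
  open import Data.List.Membership.DecPropositional (_≟ᶠ_ {n}) using () renaming (_∈?_ to _∈ₗ?_)

  erasable? : ∀ S x → Dec (Erasable G S x)
  erasable? S x = ¬? (x ∈ₗ? S) ×-dec ((val G S x ≟ 0) ×-dec
    all? (λ z → ¬? (z ∈ₗ? S) →-dec ((E z x ≟ᵇ true) →-dec ¬? (val G S z ≟ 0))))

  peeling? : ∀ s → Dec (PeelingSeq G s)
  peeling? s = all? (λ i → erasable? (take (toℕ i) s) (lookup s i)) ×-dec all? (λ x → ¬? (erasable? s x))

  valid-length : ∀ s → ValidSeq G s → length s ≤ n
  valid-length s valid with length s ≤? n
  ... | yes short = short
  ... | no long with i , j , i<j , same ← pigeonhole (≰⇒> long) (lookup s) =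
    ⊥-elim (proj₁ (valid j) (subst (_∈ take (toℕ j) s) same (lookup∈take s i (toℕ j) i<j)))

  extendable? : ∀ p → Dec (∃[ s′ ] PeelingSeq G (p ++ s′))
  extendable? p with any? (λ (ℓ : Fin (suc n)) → exists-of-length? (toℕ ℓ) (PeelingSeq G ∘ (p ++_)) (peeling? ∘ (p ++_)))
  ... | yes (_ , s′ , _ , peeling) = yes (s′ , peeling)
  ... | no none = no λ { (s′ , peeling) → none (ℓ s′ peeling , s′ , sym (toℕ-fromℕ< _) , peeling) }
    where
    ℓ : ∀ s′ → PeelingSeq G (p ++ s′) → Fin (suc n)
    ℓ s′ peeling = fromℕ< (s≤s (≤-trans (length-++-≤ʳ s′ {p}) (valid-length (p ++ s′) (proj₁ peeling))))

  ssf? : ∀ A U f → Dec (SSF G A U f)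
  ssf? A U f = encodes? ×-dec map′
      (λ { (p , size , sameSet , ext , ordered) → p , (size , sameSet , ext) , ordered })
      (λ { (p , (size , sameSet , ext) , ordered) → p , size , sameSet , ext , ordered })
      (exists-of-length? ∣ A ∣ (λ p → SameSet G A p × (∃[ s′ ] PeelingSeq G (p ++ s′)) × Ordered U f p)
         (λ p → sameSet? p ×-dec (extendable? p ×-dec ordered? p)))
    where
    encodes? : Dec (EncodesFun G A f)
    encodes? = all? λ z → ((z ∈? A) →-dec (1 ≤? vlookup f z)) ×-dec (¬? (z ∈? A) →-dec (vlookup f z ≟ 0))
    sameSet? : ∀ p → Dec (SameSet G A p)
    sameSet? p = all? (λ z → (z ∈? A) ⇔-dec (z ∈ₗ? p))
    ordered? : ∀ p → Dec (Ordered U f p)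
    ordered? p = all? λ i → all? λ j → (i <ᶠ? j) →-dec
      ((_ ≤? _) ×-dec ((lookup p j ∈? U (lookup p i)) →-dec (_ <? _)))

Bounded : ℕ → Vec ℕ n → Set
Bounded B f = ∀ z → vlookup f z < B

vectorsOver : List ℕ → (n : ℕ) → List (Vec ℕ n)
vectorsOver D zero    = [] ∷ []
vectorsOver D (suc n) = cartesianProductWith _∷_ D (vectorsOver D n)

vectorsOver-complete : (D : List ℕ) (v : Vec ℕ n) → (∀ z → vlookup v z ∈ D) → v ∈ vectorsOver D n
vectorsOver-complete D []      _       = here refl
vectorsOver-complete D (x ∷ v) entries =
  ∈-cartesianProductWith⁺ _∷_ (entries Fin.zero) (vectorsOver-complete D v (entries ∘ Fin.suc))

hasCard-bounded : (P : Vec ℕ n → Set) (B : ℕ) → (∀ f → P f → Bounded B f)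
  → (∀ f → Bounded B f → Dec (P f)) → ∃[ c ] HasCard P c
hasCard-bounded {n} P B bounded P? = length members , members , deduplicate-! (≡-dec _≟_) _ , refl , member
  where
  BoundedP : Vec ℕ n → Set
  BoundedP f = Bounded B f × P f

  boundedP? : ∀ f → Dec (BoundedP f)
  boundedP? f with all? (λ z → vlookup f z <? B)
  ... | yes f<B = map′ (f<B ,_) proj₂ (P? f f<B)
  ... | no ¬f<B = no (¬f<B ∘ proj₁)

  candidates : List (Vec ℕ n)
  candidates = vectorsOver (upTo B) n

  members : List (Vec ℕ n)
  members = deduplicate (≡-dec _≟_) (filter boundedP? candidates)

  member : ∀ f → (f ∈ members) ⇔ P f
  member f = mk⇔
    (λ f∈ → proj₂ (proj₂ (∈-filter⁻ boundedP? {xs = candidates} (∈-deduplicate⁻ (≡-dec _≟_) _ f∈))))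
    (λ Pf → ∈-deduplicate⁺ (≡-dec _≟_)
      (∈-filter⁺ boundedP? (vectorsOver-complete (upTo B) f (λ z → ∈-upTo⁺ (bounded f Pf z))) (bounded f Pf , Pf)))

lookup≤sum : (v : Vec ℕ k) (t : Fin k) → vlookup v t ≤ vsum v
lookup≤sum (x ∷ v) Fin.zero    = m≤m+n x (vsum v)
lookup≤sum (x ∷ v) (Fin.suc t) = ≤-trans (lookup≤sum v t) (m≤n+m (vsum v) x)

hasMonomial? : (A : Subset n) (f : Vec ℕ n) (idx α : Vec ℕ k) (B : ℕ)
  → Bounded B f → (∀ t → vlookup idx t < B) → Dec (HasMonomial A f idx α)
hasMonomial? A f idx α B f<B idx<B =
  map′ everywhere (λ monomial _ → monomial _) (allUpTo? (λ m → (1 ≤? m) →-dec (fibre A f m ≟ expAt idx α m)) B)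
  where
  everywhere : (∀ {m} → m < B → 1 ≤ m → fibre A f m ≡ expAt idx α m) → HasMonomial A f idx α
  everywhere below m 1≤m with m <? B
  ... | yes m<B = below m<B 1≤m
  ... | no m≮B = trans (fibre-zero A f m (λ z _ eq → m≮B (subst (_< B) eq (f<B z))))
                       (sym (expAt-absent idx α m (λ { (t , eq) → m≮B (subst (_< B) eq (idx<B t)) })))

coefficient-exists : (G : ValuedDigraph n) (A : Subset n) (U : Fin n → Subset n)
  {idx : Vec ℕ k} → StrictIncPos idx → (α : Vec ℕ k) → ∃[ c ] ΓCoeff G A U idx α c
coefficient-exists G A U {idx} inc α = hasCard-bounded (Counted G A U idx α) B bounded decide
  where
  B : ℕ
  B = suc (vsum idx)

  idx<B : ∀ t → vlookup idx t < B
  idx<B t = s≤s (lookup≤sum idx t)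

  bounded : ∀ f → Counted G A U idx α f → Bounded B f
  bounded f (ssf , monomial) = below
    where
    open Monomial A inc α f (λ z → proj₁ (proj₁ ssf z)) monomial
    below : Bounded B f
    below z with z ∈? A
    ... | yes z∈A with t , eq ← values-occur z z∈A = subst (_< B) eq (idx<B t)
    ... | no z∉A = subst (_< B) (sym (proj₂ (proj₁ ssf z) z∉A)) (s≤s z≤n)

  decide : ∀ f → Bounded B f → Dec (Counted G A U idx α f)
  decide f f<B = SSFDecidable.ssf? G A U f ×-dec hasMonomial? A f idx α B f<B idx<B

proposition16 : ∀ {n} (G : ValuedDigraph n) (A : Subset n) → IS G A → (U : Fin n → Subset n) → QuasiSymmetric (ΓCoeff G A U)
proposition16 G A _ U k idx jdx α inc-i inc-j _ =
  let c , coefficient-idx = coefficient-exists G A U inc-i α in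
  c , coefficient-idx ,
  hasCard-bijection (vmap (expAt idx jdx)) (vmap (expAt jdx idx))
    forward.counted-relabel backward.counted-relabel
    forward.counted-inverse backward.counted-inverse
    coefficient-idx
  where
  module forward  = CountedRelabelling G A U α inc-i inc-j
  module backward = CountedRelabelling G A U α inc-j inc-i
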